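{- Let $n$ and $m$ be positive integers with $m\geq n+1$. For every integer $r$ with $1\leq r\leq m-1$, the number of $(n,m)$-lattice paths $P$ with $NPL(P)=r$ equals the number of $(n,m)$-lattice paths $P=(x_1,y_1)(x_2,y_2)\cdots(x_{n+1},y_{n+1})$ with $NPL(P)=0$ and $x_{n+1}=1$; in particular it is independent of $r$.
   Context: An $(n,m)$-lattice path is a sequence $P=(x_1,y_1)(x_2,y_2)\cdots(x_{n+1},y_{n+1})$ of vectors in $\mathbb{Z}^2$ such that $1-n\leq y_i\leq 1$ for all $i$, $\sum_{i=1}^{n+1}y_i=1$, $1\leq x_i\leq m-1$ for all $i$, and $\sum_{i=1}^{n+1}x_i=m$. For such $P$, let $NP(P)=\{i\in\{1,\ldots,n+1\}\mid \sum_{j=1}^{i}y_j\leq 0\}$, and define the non-positive length $NPL(P)=\sum_{i\in NP(P)}x_i$. -}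

module Defs where

open import Data.Nat using (ℕ; suc)
open import Data.Integer using (ℤ; +_; _+_; _-_; _≤_; _≤?_; 0ℤ; 1ℤ)
open import Data.Product using (_×_; _,_; proj₁; proj₂; Σ)
open import Data.Bool using (if_then_else_)
open import Data.Vec using (Vec; []; _∷_; map; last)
open import Data.Vec.Relation.Unary.All using (All)
open import Relation.Nullary using (does)
open import Relation.Binary.PropositionalEquality using (_≡_)

Step : Set
Step = ℤ × ℤ

sumℤ : ∀ {k} → Vec ℤ k → ℤ
sumℤ []       = 0ℤ
sumℤ (a ∷ as) = a + sumℤ as

StepOK : ℕ → ℕ → Step → Set
StepOK n m (x , y) = ((1ℤ - + n) ≤ y × y ≤ 1ℤ) × (1ℤ ≤ x × x ≤ (+ m - 1ℤ))

record IsLatticePath (n m : ℕ) (P : Vec Step (suc n)) : Set where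
  field
    bounds : All (StepOK n m) P
    sumY   : sumℤ (map proj₂ P) ≡ 1ℤ
    sumX   : sumℤ (map proj₁ P) ≡ + m

LatticePath : ℕ → ℕ → Set
LatticePath n m = Σ (Vec Step (suc n)) (IsLatticePath n m)

-- NPL with running partial sum acc = y_1 + ... + y_{i-1}:
-- add x_i exactly when y_1 + ... + y_i ≤ 0.
nplFrom : ∀ {k} → ℤ → Vec Step k → ℤ
nplFrom acc []             = 0ℤ
nplFrom acc ((x , y) ∷ ps) =
  (if does ((acc + y) ≤? 0ℤ) then x else 0ℤ) + nplFrom (acc + y) ps

NPL : ∀ {k} → Vec Step k → ℤ
NPL = nplFrom 0ℤ

lastX : ∀ {n} → Vec Step (suc n) → ℤ
lastX P = proj₁ (last P)

-- Encode a path by its y-steps, a walk from 0 to 1 with steps at most 1, and its x-steps, a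
-- composition of m into n + 1 parts.  NPL(P) is the total of the parts sitting at the steps where the
-- walk is at a non-positive height, so for a fixed walk with a such steps the paths with NPL = r are
-- the interleavings of a composition u of r into a parts with a composition v of m - r into n + 1 - a
-- parts.  Rotating a walk at its first return to 0 (undone by rotating at its last visit to 1) lowers
-- a by one, so for a ≤ n there are as many walks with a non-positive steps as with none.  Gluing the
-- last part of u to the first part of v turns the pairs (u , v) into the compositions of m - 1 into
-- n parts, and these are exactly the x-steps of the paths with NPL = 0 and x_{n+1} = 1 with the final
-- step removed.

module Submission where

open import Defs
open import Data.Nat using (ℕ; suc; _≤_; _∸_)
open import Data.Integer using (ℤ; +_; 0ℤ; 1ℤ)
open import Data.Product using (Σ; _×_; proj₁)
open import Function.Bundles using (_↔_)
open import Relation.Binary.PropositionalEquality using (_≡_)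

open import Data.Bool using (Bool; true; false)
open import Data.Empty using (⊥-elim)
open import Data.Integer using (-[1+_]; -1ℤ; _+_; _-_; _≟_; +≤+; -≤-; ∣_∣)
  renaming (_≤_ to _≤ℤ_; _≤?_ to _≤ℤ?_)
import Data.Integer.Properties as ℤ
import Data.Integer.Tactic.RingSolver as ℤ-Solver
open import Data.List using (List; []; _∷_; _++_; _∷ʳ_; length; map; initLast; _∷ʳ′_)
open import Data.List.Properties using (++-cancelˡ; ∷-injective; ∷ʳ-injectiveˡ; length-++; length-++-comm)
open import Data.List.Relation.Unary.All as All using (All; []; _∷_)
open import Data.List.Relation.Unary.All.Properties using (++⁺; ++⁻)
open import Data.Nat using (zero; z≤n; s≤s; _<_; _≤?_) renaming (_+_ to _+ℕ_)
open import Data.Nat.ListAction using (sum)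
import Data.Nat.Properties as ℕ
import Data.Nat.Tactic.RingSolver as ℕ-Solver
open import Data.Product using (_,_; proj₂)
open import Data.Product.Function.Dependent.Propositional using (Σ-↔)
open import Data.Product.Function.NonDependent.Propositional using (_×-↔_)
open import Data.Sum using (_⊎_; inj₁; inj₂)
open import Data.Vec as Vec using (Vec; []; _∷_)
open import Data.Vec.Properties using (length-toList)
import Data.Vec.Relation.Unary.All as VecAll
open import Function.Bundles using (Inverse; mk↔ₛ′)
open import Function.Properties.Inverse using (↔-refl; ↔-trans; ↔-sym)
open import Function.Related.TypeIsomorphisms using (×-comm)
open import Relation.Binary.PropositionalEquality using (_≢_; refl; sym; trans; cong; cong₂; subst; module ≡-Reasoning)
open import Relation.Binary.PropositionalEquality.WithK using (≡-irrelevant)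
open import Relation.Nullary using (does; yes; no; ¬_; Irrelevant)
open import Relation.Nullary.Decidable using (dec-true)

×-irrelevant : ∀ {A B : Set} → Irrelevant A → Irrelevant B → Irrelevant (A × B)
×-irrelevant irrA irrB (a , b) (a′ , b′) = cong₂ _,_ (irrA a a′) (irrB b b′)

Σ-≡-irrelevant : ∀ {A : Set} {P : A → Set} → (∀ {a} → Irrelevant (P a)) →
                 {x y : Σ A P} → proj₁ x ≡ proj₁ y → x ≡ y
Σ-≡-irrelevant irr {a , p} {.a , q} refl = cong (a ,_) (irr p q)

restrict-↔ : ∀ {A B : Set} {P : A → Set} {Q : B → Set} (f : A ↔ B) →
             (∀ {a} → Irrelevant (P a)) → (∀ {b} → Irrelevant (Q b)) →
             (∀ {b} → P (Inverse.from f b) → Q b) → (∀ {b} → Q b → P (Inverse.from f b)) →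
             Σ A P ↔ Σ B Q
restrict-↔ f P-irrelevant Q-irrelevant P⇒Q Q⇒P =
  ↔-sym (Σ-↔ (↔-sym f) (mk↔ₛ′ Q⇒P P⇒Q (λ _ → P-irrelevant _ _) (λ _ → Q-irrelevant _ _)))

Σ-×-↔ : ∀ {A C : Set} {P B : A → Set} → (∀ {a} → P a → B a ↔ C) →
        Σ A (λ a → P a × B a) ↔ (Σ A P × C)
Σ-×-↔ f = mk↔ₛ′
  (λ (a , p , b) → (a , p) , Inverse.to (f p) b)
  (λ ((a , p) , c) → a , p , Inverse.from (f p) c)
  (λ ((a , p) , c) → cong ((a , p) ,_) (Inverse.strictlyInverseˡ (f p) c))
  (λ (a , p , b) → cong (λ b′ → a , p , b′) (Inverse.strictlyInverseʳ (f p) b))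

-- Boolean masks

#true : List Bool → ℕ
#true []           = 0
#true (true  ∷ bs) = suc (#true bs)
#true (false ∷ bs) = #true bs

#false : List Bool → ℕ
#false []           = 0
#false (true  ∷ bs) = #false bs
#false (false ∷ bs) = suc (#false bs)

#true-++ : ∀ bs cs → #true (bs ++ cs) ≡ #true bs +ℕ #true cs
#true-++ []           cs = refl
#true-++ (true  ∷ bs) cs = cong suc (#true-++ bs cs)
#true-++ (false ∷ bs) cs = #true-++ bs cs

#true+#false : ∀ bs → #true bs +ℕ #false bs ≡ length bs
#true+#false []           = refl
#true+#false (true  ∷ bs) = cong suc (#true+#false bs)
#true+#false (false ∷ bs) = trans (ℕ.+-suc (#true bs) _) (cong suc (#true+#false bs))

module _ {A : Set} where

  select : List Bool → List A → List A
  select (true  ∷ bs) (x ∷ xs) = x ∷ select bs xs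
  select (false ∷ bs) (x ∷ xs) = select bs xs
  select _            _        = []

  reject : List Bool → List A → List A
  reject (true  ∷ bs) (x ∷ xs) = reject bs xs
  reject (false ∷ bs) (x ∷ xs) = x ∷ reject bs xs
  reject _            _        = []

  merge : List Bool → List A → List A → List A
  merge (true  ∷ bs) (x ∷ u) v       = x ∷ merge bs u v
  merge (false ∷ bs) u       (x ∷ v) = x ∷ merge bs u v
  merge _            _       _       = []

  length-select : ∀ bs xs → length xs ≡ length bs → length (select bs xs) ≡ #true bs
  length-select []           []       _   = refl
  length-select (true  ∷ bs) (_ ∷ xs) len = cong suc (length-select bs xs (ℕ.suc-injective len))
  length-select (false ∷ bs) (_ ∷ xs) len = length-select bs xs (ℕ.suc-injective len)

  length-reject : ∀ bs xs → length xs ≡ length bs → length (reject bs xs) ≡ #false bs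
  length-reject []           []       _   = refl
  length-reject (true  ∷ bs) (_ ∷ xs) len = length-reject bs xs (ℕ.suc-injective len)
  length-reject (false ∷ bs) (_ ∷ xs) len = cong suc (length-reject bs xs (ℕ.suc-injective len))

  length-merge : ∀ bs u v → length u ≡ #true bs → length v ≡ #false bs → length (merge bs u v) ≡ length bs
  length-merge []           []      []      _     _     = refl
  length-merge (true  ∷ bs) (_ ∷ u) v       len-u len-v = cong suc (length-merge bs u v (ℕ.suc-injective len-u) len-v)
  length-merge (false ∷ bs) u       (_ ∷ v) len-u len-v = cong suc (length-merge bs u v len-u (ℕ.suc-injective len-v))

  merge-select-reject : ∀ bs xs → length xs ≡ length bs → merge bs (select bs xs) (reject bs xs) ≡ xs
  merge-select-reject []           []       _   = refl
  merge-select-reject (true  ∷ bs) (x ∷ xs) len = cong (x ∷_) (merge-select-reject bs xs (ℕ.suc-injective len))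
  merge-select-reject (false ∷ bs) (x ∷ xs) len = cong (x ∷_) (merge-select-reject bs xs (ℕ.suc-injective len))

  select-merge : ∀ bs u v → length u ≡ #true bs → length v ≡ #false bs → select bs (merge bs u v) ≡ u
  select-merge []           []      []      _     _     = refl
  select-merge (true  ∷ bs) (x ∷ u) v       len-u len-v = cong (x ∷_) (select-merge bs u v (ℕ.suc-injective len-u) len-v)
  select-merge (false ∷ bs) u       (x ∷ v) len-u len-v = select-merge bs u v len-u (ℕ.suc-injective len-v)

  reject-merge : ∀ bs u v → length u ≡ #true bs → length v ≡ #false bs → reject bs (merge bs u v) ≡ v
  reject-merge []           []      []      _     _     = refl
  reject-merge (true  ∷ bs) (x ∷ u) v       len-u len-v = reject-merge bs u v (ℕ.suc-injective len-u) len-v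
  reject-merge (false ∷ bs) u       (x ∷ v) len-u len-v = cong (x ∷_) (reject-merge bs u v len-u (ℕ.suc-injective len-v))

select-none : ∀ {A : Set} bs (xs : List A) → #true bs ≡ 0 → select bs xs ≡ []
select-none []           _        _   = refl
select-none (false ∷ bs) []       _   = refl
select-none (false ∷ bs) (_ ∷ xs) none = select-none bs xs none
select-none (true  ∷ bs) _        ()

-- Walks with steps at most 1

∑ : List ℤ → ℤ
∑ []       = 0ℤ
∑ (y ∷ ys) = y + ∑ ys

∑-++ : ∀ u v → ∑ (u ++ v) ≡ ∑ u + ∑ v
∑-++ []      v = sym (ℤ.+-identityˡ (∑ v))
∑-++ (y ∷ u) v = trans (cong (_+_ y) (∑-++ u v)) (sym (ℤ.+-assoc y (∑ u) (∑ v)))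

nonPosMask : ℤ → List ℤ → List Bool
nonPosMask s []       = []
nonPosMask s (y ∷ ys) = does (s + y ≤ℤ? 0ℤ) ∷ nonPosMask (s + y) ys

#nonPos : ℤ → List ℤ → ℕ
#nonPos s ys = #true (nonPosMask s ys)

length-nonPosMask : ∀ s ys → length (nonPosMask s ys) ≡ length ys
length-nonPosMask s []       = refl
length-nonPosMask s (y ∷ ys) = cong suc (length-nonPosMask (s + y) ys)

nonPosMask-++ : ∀ s u v → nonPosMask s (u ++ v) ≡ nonPosMask s u ++ nonPosMask (s + ∑ u) v
nonPosMask-++ s []      v = cong (λ t → nonPosMask t v) (sym (ℤ.+-identityʳ s))
nonPosMask-++ s (y ∷ u) v =
  cong (does (s + y ≤ℤ? 0ℤ) ∷_)
    (trans (nonPosMask-++ (s + y) u v) (cong (λ t → nonPosMask (s + y) u ++ nonPosMask t v) (ℤ.+-assoc s y (∑ u))))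

#nonPos-++ : ∀ s u v → #nonPos s (u ++ v) ≡ #nonPos s u +ℕ #nonPos (s + ∑ u) v
#nonPos-++ s u v = trans (cong #true (nonPosMask-++ s u v)) (#true-++ (nonPosMask s u) _)

+1-shift : ∀ s y → (s + 1ℤ) + y ≡ (s + y) + 1ℤ
+1-shift = ℤ-Solver.solve-∀

≤0-shift : ∀ z → z ≢ 0ℤ → does (z ≤ℤ? 0ℤ) ≡ does (z + 1ℤ ≤ℤ? 0ℤ)
≤0-shift (+ zero)     z≢0 = ⊥-elim (z≢0 refl)
≤0-shift (+ suc _)    _   = refl
≤0-shift -[1+ zero ]  _   = refl
≤0-shift -[1+ suc _ ] _   = refl

≤0∧≢0⇒≤-1 : ∀ {z} → z ≤ℤ 0ℤ → z ≢ 0ℤ → z ≤ℤ -1ℤ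
≤0∧≢0⇒≤-1 {+ zero}   _         z≢0 = ⊥-elim (z≢0 refl)
≤0∧≢0⇒≤-1 {+ suc _}  (+≤+ ())  _
≤0∧≢0⇒≤-1 { -[1+ _ ]} _         _   = -≤- z≤n

data FirstPassage : ℤ → List ℤ → Set where
  arrive : ∀ {s y}   → s + y ≡ 0ℤ → FirstPassage s (y ∷ [])
  pass   : ∀ {s y g} → s + y ≢ 0ℤ → FirstPassage (s + y) g → FirstPassage s (y ∷ g)

FirstPassage-nonempty : ∀ {s g} → FirstPassage s g → g ≢ []
FirstPassage-nonempty (arrive _) ()
FirstPassage-nonempty (pass _ _) ()

FirstPassage-∑ : ∀ {s g} → FirstPassage s g → s + ∑ g ≡ 0ℤ
FirstPassage-∑ (arrive {s} {y} s+y≡0) = trans (cong (_+_ s) (ℤ.+-identityʳ y)) s+y≡0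
FirstPassage-∑ (pass {s} {y} {g} _ fp) = trans (sym (ℤ.+-assoc s y (∑ g))) (FirstPassage-∑ fp)

-- Raising the start by one loses exactly the final visit to 0.
FirstPassage-#nonPos : ∀ {s g} → FirstPassage s g → #nonPos s g ≡ suc (#nonPos (s + 1ℤ) g)
FirstPassage-#nonPos (arrive {s} {y} s+y≡0) rewrite +1-shift s y | s+y≡0 = refl
FirstPassage-#nonPos (pass {s} {y} s+y≢0 fp)
  rewrite +1-shift s y | sym (≤0-shift (s + y) s+y≢0) with s + y ≤ℤ? 0ℤ
... | yes _ = cong suc (FirstPassage-#nonPos fp)
... | no _  = FirstPassage-#nonPos fp

FirstPassage-prefix≢0 : ∀ {s y e g} → FirstPassage s (y ∷ e ++ g) → g ≢ [] → s + ∑ (y ∷ e) ≢ 0ℤ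
FirstPassage-prefix≢0 {s} {y} {[]}     (arrive _)       g≢[] _  = g≢[] refl
FirstPassage-prefix≢0 {s} {y} {[]}     (pass s+y≢0 _)   _    eq =
  s+y≢0 (trans (cong (_+_ s) (sym (ℤ.+-identityʳ y))) eq)
FirstPassage-prefix≢0 {s} {y} {y′ ∷ e} (pass _ fp)      g≢[] eq =
  FirstPassage-prefix≢0 fp g≢[] (trans (ℤ.+-assoc s y (∑ (y′ ∷ e))) eq)

FirstPassage-unique : ∀ {s g₁ g₂ d₁ d₂} → FirstPassage s g₁ → FirstPassage s g₂ →
                      g₁ ++ d₁ ≡ g₂ ++ d₂ → g₁ ≡ g₂
FirstPassage-unique (arrive _)    (arrive _)    eq = cong (_∷ []) (proj₁ (∷-injective eq))
FirstPassage-unique (arrive s+y≡0) (pass s+y≢0 _) eq with refl ← proj₁ (∷-injective eq) = ⊥-elim (s+y≢0 s+y≡0)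
FirstPassage-unique (pass s+y≢0 _) (arrive s+y≡0) eq with refl ← proj₁ (∷-injective eq) = ⊥-elim (s+y≢0 s+y≡0)
FirstPassage-unique (pass _ fp₁)  (pass _ fp₂)  eq with refl , eq′ ← ∷-injective eq =
  cong (_ ∷_) (FirstPassage-unique fp₁ fp₂ eq′)

FirstVisitSplit : ℤ → List ℤ → Set
FirstVisitSplit s ys = Σ (List ℤ) λ g → Σ (List ℤ) λ d → ys ≡ g ++ d × FirstPassage s g

LastVisitSplit : ℤ → List ℤ → Set
LastVisitSplit s zs = Σ (List ℤ) λ d → Σ (List ℤ) λ g → zs ≡ d ++ g × s + ∑ d ≡ 0ℤ × FirstPassage 0ℤ g

lastVisit-unique : ∀ {s d₁ d₂ g₁ g₂} → s + ∑ d₁ ≡ 0ℤ → s + ∑ d₂ ≡ 0ℤ →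
                   FirstPassage 0ℤ g₁ → FirstPassage 0ℤ g₂ → d₁ ++ g₁ ≡ d₂ ++ g₂ → d₁ ≡ d₂
lastVisit-unique {s} {[]}     {[]}     _  _  _   _   _  = refl
lastVisit-unique {s} {[]}     {z ∷ d₂} h₁ h₂ fp₁ fp₂ refl =
  ⊥-elim (FirstPassage-prefix≢0 fp₁ (FirstPassage-nonempty fp₂) (trans (cong (_+ ∑ (z ∷ d₂)) (sym s≡0)) h₂))
  where s≡0 = trans (sym (ℤ.+-identityʳ s)) h₁
lastVisit-unique {s} {z ∷ d₁} {[]}     h₁ h₂ fp₁ fp₂ refl =
  ⊥-elim (FirstPassage-prefix≢0 fp₂ (FirstPassage-nonempty fp₁) (trans (cong (_+ ∑ (z ∷ d₁)) (sym s≡0)) h₁))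
  where s≡0 = trans (sym (ℤ.+-identityʳ s)) h₂
lastVisit-unique {s} {y ∷ d₁} {_ ∷ d₂} h₁ h₂ fp₁ fp₂ eq with refl , eq′ ← ∷-injective eq =
  cong (y ∷_) (lastVisit-unique {s + y} (trans (ℤ.+-assoc s y _) h₁) (trans (ℤ.+-assoc s y _) h₂) fp₁ fp₂ eq′)

-- Steps are at most 1, so a walk cannot climb from below 0 to above 0 without visiting 0.
firstVisit-fromBelow : ∀ {s ys} → s ≤ℤ -1ℤ → 0ℤ ≤ℤ s + ∑ ys → All (_≤ℤ 1ℤ) ys → FirstVisitSplit s ys
firstVisit-fromBelow {s} {[]}     s≤-1 0≤s+0 []
  with () ← ℤ.≤-trans 0≤s+0 (ℤ.≤-trans (ℤ.≤-reflexive (ℤ.+-identityʳ s)) s≤-1)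
firstVisit-fromBelow {s} {y ∷ ys} s≤-1 0≤end (y≤1 ∷ steps) with s + y ≟ 0ℤ
... | yes s+y≡0 = y ∷ [] , ys , refl , arrive s+y≡0
... | no  s+y≢0 =
  let g , d , ys≡gd , fp = firstVisit-fromBelow (≤0∧≢0⇒≤-1 (ℤ.+-mono-≤ s≤-1 y≤1) s+y≢0)
                             (ℤ.≤-trans 0≤end (ℤ.≤-reflexive (sym (ℤ.+-assoc s y (∑ ys))))) steps
  in y ∷ g , d , cong (y ∷_) ys≡gd , pass s+y≢0 fp

firstVisit : ∀ {s ys} → 0ℤ ≤ℤ s + ∑ ys → All (_≤ℤ 1ℤ) ys → 0 < #nonPos s ys → FirstVisitSplit s ys
firstVisit {s} {y ∷ ys} 0≤end (y≤1 ∷ steps) visits with s + y ≟ 0ℤ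
... | yes s+y≡0 = y ∷ [] , ys , refl , arrive s+y≡0
... | no  s+y≢0 =
  let g , d , ys≡gd , fp = rest in y ∷ g , d , cong (y ∷_) ys≡gd , pass s+y≢0 fp
  where
  0≤end′ : 0ℤ ≤ℤ (s + y) + ∑ ys
  0≤end′ = ℤ.≤-trans 0≤end (ℤ.≤-reflexive (sym (ℤ.+-assoc s y (∑ ys))))
  rest : FirstVisitSplit (s + y) ys
  rest with s + y ≤ℤ? 0ℤ
  ... | yes s+y≤0 = firstVisit-fromBelow (≤0∧≢0⇒≤-1 s+y≤0 s+y≢0) 0≤end′ steps
  ... | no  _     = firstVisit 0≤end′ steps visits

lastVisit-or-firstPassage : ∀ {s z zs} → s + ∑ (z ∷ zs) ≡ 0ℤ →
                            LastVisitSplit s (z ∷ zs) ⊎ FirstPassage s (z ∷ zs)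
lastVisit-or-firstPassage {s} {z} {[]}      end = inj₂ (arrive (trans (cong (_+_ s) (sym (ℤ.+-identityʳ z))) end))
lastVisit-or-firstPassage {s} {z} {z′ ∷ zs} end with lastVisit-or-firstPassage {s + z} (trans (ℤ.+-assoc s z _) end)
... | inj₁ (d , g , eq , s+z+∑d≡0 , fp) =
  inj₁ (z ∷ d , g , cong (z ∷_) eq , trans (sym (ℤ.+-assoc s z (∑ d))) s+z+∑d≡0 , fp)
... | inj₂ fp with s + z ≟ 0ℤ
...   | yes s+z≡0 = inj₁ (z ∷ [] , z′ ∷ zs , refl , trans (cong (_+_ s) (ℤ.+-identityʳ z)) s+z≡0 ,
                          subst (λ t → FirstPassage t (z′ ∷ zs)) s+z≡0 fp)
...   | no  s+z≢0 = inj₂ (pass s+z≢0 fp)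

-- Starting below 0, every proper prefix of a first passage stays below 0.
FirstPassage-#nonPos-fromBelow : ∀ {s zs} → FirstPassage s zs → s ≤ℤ -1ℤ → All (_≤ℤ 1ℤ) zs →
                                 suc (#nonPos (s + 1ℤ) zs) ≡ length zs
FirstPassage-#nonPos-fromBelow (arrive {s} {z} s+z≡0) _ _ rewrite +1-shift s z | s+z≡0 = refl
FirstPassage-#nonPos-fromBelow (pass {s} {z} s+z≢0 fp) s≤-1 (z≤1 ∷ steps)
  with s+z≤-1 ← ≤0∧≢0⇒≤-1 (ℤ.+-mono-≤ s≤-1 z≤1) s+z≢0
  rewrite +1-shift s z | dec-true ((s + z) + 1ℤ ≤ℤ? 0ℤ) (ℤ.+-monoˡ-≤ 1ℤ s+z≤-1) =
  cong suc (FirstPassage-#nonPos-fromBelow fp s+z≤-1 steps)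

rotateAt : ∀ {s ys} → FirstVisitSplit s ys → List ℤ
rotateAt (g , d , _) = d ++ g

unrotateAt : ∀ {s zs} → LastVisitSplit s zs → List ℤ
unrotateAt (d , g , _) = g ++ d

rotateAt-unique : ∀ {s g d} (S : FirstVisitSplit s (g ++ d)) → FirstPassage s g → rotateAt S ≡ d ++ g
rotateAt-unique {g = g} (g′ , d′ , eq , fp′) fp with refl ← FirstPassage-unique fp fp′ eq =
  cong (_++ g) (sym (++-cancelˡ g _ _ eq))

unrotateAt-unique : ∀ {s d g} (T : LastVisitSplit s (d ++ g)) → s + ∑ d ≡ 0ℤ → FirstPassage 0ℤ g →
                    unrotateAt {s} T ≡ g ++ d
unrotateAt-unique {s} {d} (d′ , g′ , eq , h′ , fp′) h fp with refl ← lastVisit-unique {s} h h′ fp fp′ eq =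
  cong (_++ d) (sym (++-cancelˡ d _ _ eq))

FirstPassage-∑-suffix : ∀ {g d} → FirstPassage 0ℤ g → ∑ (g ++ d) ≡ 1ℤ → ∑ d ≡ 1ℤ
FirstPassage-∑-suffix {g} {d} fp ∑≡1 = begin
  ∑ d           ≡⟨ sym (ℤ.+-identityˡ (∑ d)) ⟩
  0ℤ + ∑ d      ≡⟨ cong (_+ ∑ d) (sym ∑g≡0) ⟩
  ∑ g + ∑ d     ≡⟨ sym (∑-++ g d) ⟩
  ∑ (g ++ d)    ≡⟨ ∑≡1 ⟩
  1ℤ            ∎
  where
  open ≡-Reasoning
  ∑g≡0 = trans (sym (ℤ.+-identityˡ (∑ g))) (FirstPassage-∑ fp)

#nonPos-rotate : ∀ {g d} → FirstPassage 0ℤ g → ∑ d ≡ 1ℤ → #nonPos 0ℤ (g ++ d) ≡ suc (#nonPos 0ℤ (d ++ g))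
#nonPos-rotate {g} {d} fp ∑d≡1 = begin
  #nonPos 0ℤ (g ++ d)                         ≡⟨ #nonPos-++ 0ℤ g d ⟩
  #nonPos 0ℤ g +ℕ #nonPos (0ℤ + ∑ g) d        ≡⟨ cong₂ _+ℕ_ (FirstPassage-#nonPos fp)
                                                            (cong (λ t → #nonPos t d) (FirstPassage-∑ fp)) ⟩
  suc (#nonPos 1ℤ g +ℕ #nonPos 0ℤ d)          ≡⟨ cong suc (ℕ.+-comm (#nonPos 1ℤ g) _) ⟩
  suc (#nonPos 0ℤ d +ℕ #nonPos 1ℤ g)          ≡⟨ cong (λ t → suc (#nonPos 0ℤ d +ℕ #nonPos t g)) (sym 0+∑d≡1) ⟩
  suc (#nonPos 0ℤ d +ℕ #nonPos (0ℤ + ∑ d) g)  ≡⟨ cong suc (sym (#nonPos-++ 0ℤ d g)) ⟩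
  suc (#nonPos 0ℤ (d ++ g))                   ∎
  where
  open ≡-Reasoning
  0+∑d≡1 = trans (ℤ.+-identityˡ (∑ d)) ∑d≡1

-1+x≡0⇒x≡1 : ∀ {x} → -1ℤ + x ≡ 0ℤ → x ≡ 1ℤ
-1+x≡0⇒x≡1 {x} h = trans (sym (cancel x)) (cong (_+ 1ℤ) h)
  where
  cancel : ∀ x → (-1ℤ + x) + 1ℤ ≡ x
  cancel = ℤ-Solver.solve-∀

module Rotation (P : ℤ → Set) (P-irrelevant : ∀ {y} → Irrelevant (P y)) (P⇒≤1 : ∀ {y} → P y → y ≤ℤ 1ℤ)
  where

  IsWalk : ℕ → List ℤ → Set
  IsWalk k ys = length ys ≡ k × All P ys × ∑ ys ≡ 1ℤ

  Walks : ℕ → ℕ → Set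
  Walks k a = Σ (List ℤ) λ ys → IsWalk k ys × #nonPos 0ℤ ys ≡ a

  IsWalk-irrelevant : ∀ {k ys} → Irrelevant (IsWalk k ys)
  IsWalk-irrelevant = ×-irrelevant ≡-irrelevant (×-irrelevant (All.irrelevant P-irrelevant) ≡-irrelevant)

  Walks-irrelevant : ∀ {k a ys} → Irrelevant (IsWalk k ys × #nonPos 0ℤ ys ≡ a)
  Walks-irrelevant = ×-irrelevant IsWalk-irrelevant ≡-irrelevant

  IsWalk-swap : ∀ {k} u v → IsWalk k (u ++ v) → IsWalk k (v ++ u)
  IsWalk-swap u v (len , steps , ∑≡1) =
    trans (length-++-comm v u) len ,
    (let steps-u , steps-v = ++⁻ u steps in ++⁺ steps-v steps-u) ,
    trans (∑-++ v u) (trans (ℤ.+-comm (∑ v) (∑ u)) (trans (sym (∑-++ u v)) ∑≡1))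

  splitAtFirstZero : ∀ {k a ys} → IsWalk k ys → #nonPos 0ℤ ys ≡ suc a → FirstVisitSplit 0ℤ ys
  splitAtFirstZero (_ , steps , ∑≡1) count =
    firstVisit (subst (0ℤ ≤ℤ_) (sym (trans (ℤ.+-identityˡ _) ∑≡1)) (+≤+ z≤n)) (All.map P⇒≤1 steps)
               (subst (0 <_) (sym count) (s≤s z≤n))

  -- Measured from -1, visits to height 1 become visits to 0.  Without such a visit before the end, every
  -- proper prefix of zs ends at a non-positive height and the count would be k.
  splitAtLastOne : ∀ {k a zs} → a < k → IsWalk (suc k) zs → #nonPos 0ℤ zs ≡ a → LastVisitSplit -1ℤ zs
  splitAtLastOne {zs = []}     _   (() , _)
  splitAtLastOne {zs = z ∷ zs} a<k (len , steps , ∑≡1) count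
    with lastVisit-or-firstPassage { -1ℤ} {z} {zs} (cong (_+_ -1ℤ) ∑≡1)
  ... | inj₁ split = split
  ... | inj₂ fp    = ⊥-elim (ℕ.<-irrefl (ℕ.suc-injective a+1≡k+1) a<k)
    where
    a+1≡k+1 = trans (cong suc (sym count))
                    (trans (FirstPassage-#nonPos-fromBelow fp ℤ.≤-refl (All.map P⇒≤1 steps)) len)

  rotateLeft : ∀ {k a} → Walks k (suc a) → Walks k a
  rotateLeft (ys , w , count) =
    let g , d , ys≡gd , fp = splitAtFirstZero w count
        ∑d≡1 = FirstPassage-∑-suffix fp (trans (cong ∑ (sym ys≡gd)) (proj₂ (proj₂ w)))
    in d ++ g , IsWalk-swap g d (subst (IsWalk _) ys≡gd w) ,
       ℕ.suc-injective (trans (sym (#nonPos-rotate fp ∑d≡1)) (trans (cong (#nonPos 0ℤ) (sym ys≡gd)) count))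

  rotateRight : ∀ {k a} → a < k → Walks (suc k) a → Walks (suc k) (suc a)
  rotateRight a<k (zs , w , count) =
    let d , g , zs≡dg , -1+∑d≡0 , fp = splitAtLastOne a<k w count
    in g ++ d , IsWalk-swap d g (subst (IsWalk _) zs≡dg w) ,
       trans (#nonPos-rotate fp (-1+x≡0⇒x≡1 -1+∑d≡0)) (cong suc (trans (cong (#nonPos 0ℤ) (sym zs≡dg)) count))

  rotation-↔ : ∀ {k a} → a < k → Walks (suc k) (suc a) ↔ Walks (suc k) a
  rotation-↔ a<k = mk↔ₛ′ rotateLeft (rotateRight a<k) left∘right right∘left
    where
    left∘right : ∀ x → rotateLeft (rotateRight a<k x) ≡ x
    left∘right x@(zs , w , count) =
      let d , g , zs≡dg , _ , fp = splitAtLastOne a<k w count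
          _ , w′ , count′ = rotateRight a<k x
      in Σ-≡-irrelevant Walks-irrelevant
           (trans (rotateAt-unique {g = g} {d} (splitAtFirstZero w′ count′) fp) (sym zs≡dg))
    right∘left : ∀ x → rotateRight a<k (rotateLeft x) ≡ x
    right∘left x@(ys , w , count) =
      let g , d , ys≡gd , fp = splitAtFirstZero w count
          _ , w′ , count′ = rotateLeft x
          ∑d≡1 = FirstPassage-∑-suffix fp (trans (cong ∑ (sym ys≡gd)) (proj₂ (proj₂ w)))
      in Σ-≡-irrelevant Walks-irrelevant
           (trans (unrotateAt-unique { -1ℤ} {d} {g} (splitAtLastOne a<k w′ count′) (cong (_+_ -1ℤ) ∑d≡1) fp)
                  (sym ys≡gd))

  Walks-↔ : ∀ {k a} → a ≤ k → Walks (suc k) a ↔ Walks (suc k) 0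
  Walks-↔ {a = zero}  _     = ↔-refl
  Walks-↔ {a = suc a} a<k   = ↔-trans (rotation-↔ a<k) (Walks-↔ (ℕ.<⇒≤ a<k))

-- Compositions

-- A list ks stands for the composition with parts 1 + k, for k in ks.
total : List ℕ → ℕ
total ks = sum (map suc ks)

total-select-reject : ∀ bs ks → length ks ≡ length bs → total (select bs ks) +ℕ total (reject bs ks) ≡ total ks
total-select-reject []           []       _   = refl
total-select-reject (true  ∷ bs) (k ∷ ks) len =
  trans (ℕ.+-assoc (suc k) _ _) (cong (suc k +ℕ_) (total-select-reject bs ks (ℕ.suc-injective len)))
total-select-reject (false ∷ bs) (k ∷ ks) len =
  trans (ℕ.+-comm (total (select bs ks)) _) (trans (ℕ.+-assoc (suc k) _ _)
    (cong (suc k +ℕ_) (trans (ℕ.+-comm _ (total (select bs ks))) (total-select-reject bs ks (ℕ.suc-injective len)))))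

total≡0 : ∀ {ks} → total ks ≡ 0 → ks ≡ []
total≡0 {[]} _ = refl

total≢0 : ∀ {ks r} → total ks ≡ suc r → ks ≢ []
total≢0 () refl

length-∷ʳ : ∀ {A : Set} (xs : List A) x → length (xs ∷ʳ x) ≡ suc (length xs)
length-∷ʳ xs x = trans (length-++ xs) (ℕ.+-comm (length xs) 1)

total-∷ʳ0 : ∀ ks → total (ks ∷ʳ 0) ≡ suc (total ks)
total-∷ʳ0 []       = refl
total-∷ʳ0 (k ∷ ks) = trans (cong (suc k +ℕ_) (total-∷ʳ0 ks)) (ℕ.+-suc (suc k) (total ks))

-- Joins the last part x of u and the first part y of v into the single part x + y - 1.
glue : List ℕ → List ℕ → List ℕ
glue []           v       = v
glue (k ∷ [])     []      = k ∷ []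
glue (k ∷ [])     (h ∷ v) = k +ℕ h ∷ v
glue (k ∷ k′ ∷ u) v       = k ∷ glue (k′ ∷ u) v

cut : ℕ → List ℕ → List ℕ × List ℕ
cut r []       = [] , []
cut r (k ∷ ks) with r ≤? k
... | yes _ = r ∷ [] , k ∸ r ∷ ks
... | no  _ = k ∷ proj₁ (cut (r ∸ suc k) ks) , proj₂ (cut (r ∸ suc k) ks)

glue-cons : ∀ k u v → u ≢ [] → glue (k ∷ u) v ≡ k ∷ glue u v
glue-cons k []      v u≢[] = ⊥-elim (u≢[] refl)
glue-cons k (_ ∷ _) v _    = refl

length-glue : ∀ u v → u ≢ [] → v ≢ [] → suc (length (glue u v)) ≡ length u +ℕ length v
length-glue []           v       u≢[] _    = ⊥-elim (u≢[] refl)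
length-glue (k ∷ [])     []      _    v≢[] = ⊥-elim (v≢[] refl)
length-glue (k ∷ [])     (h ∷ v) _    _    = refl
length-glue (k ∷ k′ ∷ u) v       _    v≢[] = cong suc (length-glue (k′ ∷ u) v (λ ()) v≢[])

total-glue : ∀ u v → u ≢ [] → v ≢ [] → suc (total (glue u v)) ≡ total u +ℕ total v
total-glue []           v       u≢[] _    = ⊥-elim (u≢[] refl)
total-glue (k ∷ [])     []      _    v≢[] = ⊥-elim (v≢[] refl)
total-glue (k ∷ [])     (h ∷ v) _    _    = arith k h (total v)
  where
  arith : ∀ k h t → suc (suc (k +ℕ h) +ℕ t) ≡ suc (k +ℕ 0) +ℕ (suc h +ℕ t)
  arith = ℕ-Solver.solve-∀
total-glue (k ∷ k′ ∷ u) v       _    v≢[] =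
  trans (sym (ℕ.+-suc (suc k) _))
    (trans (cong (suc k +ℕ_) (total-glue (k′ ∷ u) v (λ ()) v≢[])) (sym (ℕ.+-assoc (suc k) (total (k′ ∷ u)) _)))

split-suc : ∀ {k r} → k < r → suc k +ℕ suc (r ∸ suc k) ≡ suc r
split-suc {k} k<r = trans (ℕ.+-suc (suc k) _) (cong suc (ℕ.m+[n∸m]≡n k<r))

∸-total : ∀ {k r t} → k < r → suc k +ℕ t ≡ suc r → t ≡ suc (r ∸ suc k)
∸-total {k} k<r eq = ℕ.+-cancelˡ-≡ (suc k) _ _ (trans eq (sym (split-suc k<r)))

∸-bound : ∀ {k r t} → k < r → suc r ≤ suc k +ℕ t → suc (r ∸ suc k) ≤ t
∸-bound {k} {r} {t} k<r le = ℕ.+-cancelˡ-≤ (suc k) _ _ (subst (_≤ suc k +ℕ t) (sym (split-suc k<r)) le)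

cut-≤ : ∀ {r k} ks → r ≤ k → cut r (k ∷ ks) ≡ (r ∷ [] , k ∸ r ∷ ks)
cut-≤ {r} {k} ks r≤k with r ≤? k
... | yes _   = refl
... | no  r≰k = ⊥-elim (r≰k r≤k)

cut-≰ : ∀ {r k} ks → ¬ r ≤ k →
        cut r (k ∷ ks) ≡ (k ∷ proj₁ (cut (r ∸ suc k) ks) , proj₂ (cut (r ∸ suc k) ks))
cut-≰ {r} {k} ks r≰k with r ≤? k
... | yes r≤k = ⊥-elim (r≰k r≤k)
... | no  _   = refl

cut-glue : ∀ r u v → v ≢ [] → total u ≡ suc r → cut r (glue u v) ≡ (u , v)
cut-glue r []           v       _    ()
cut-glue r (k ∷ [])     []      v≢[] _       = ⊥-elim (v≢[] refl)
cut-glue r (k ∷ [])     (h ∷ v) _    total-u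
  with refl ← ℕ.suc-injective (trans (sym (ℕ.+-identityʳ (suc k))) total-u) =
  trans (cut-≤ v (ℕ.m≤m+n r h)) (cong (λ t → r ∷ [] , t ∷ v) (ℕ.m+n∸m≡n r h))
cut-glue r (k ∷ k′ ∷ u) v       v≢[] total-u =
  trans (cut-≰ (glue (k′ ∷ u) v) r≰k)
        (cong (λ p → k ∷ proj₁ p , proj₂ p)
              (cut-glue (r ∸ suc k) (k′ ∷ u) v v≢[] (∸-total (ℕ.≰⇒> r≰k) total-u)))
  where
  r≰k : ¬ r ≤ k
  r≰k r≤k = ℕ.m+1+n≰m k (subst (_≤ k) (sym (ℕ.suc-injective total-u)) r≤k)

total-cut : ∀ r ks → suc r ≤ total ks → total (proj₁ (cut r ks)) ≡ suc r
total-cut r (k ∷ ks) r<total with r ≤? k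
... | yes _   = ℕ.+-identityʳ (suc r)
... | no  r≰k =
  trans (cong (suc k +ℕ_) (total-cut (r ∸ suc k) ks (∸-bound (ℕ.≰⇒> r≰k) r<total))) (split-suc (ℕ.≰⇒> r≰k))

cut-suffix≢[] : ∀ r ks → suc r ≤ total ks → proj₂ (cut r ks) ≢ []
cut-suffix≢[] r (k ∷ ks) r<total with r ≤? k
... | yes _   = λ ()
... | no  r≰k = cut-suffix≢[] (r ∸ suc k) ks (∸-bound (ℕ.≰⇒> r≰k) r<total)

glue-cut : ∀ r ks → suc r ≤ total ks → glue (proj₁ (cut r ks)) (proj₂ (cut r ks)) ≡ ks
glue-cut r (k ∷ ks) r<total with r ≤? k
... | yes r≤k = cong (_∷ ks) (ℕ.m+[n∸m]≡n r≤k)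
... | no  r≰k =
  trans (glue-cons k (proj₁ (cut r′ ks)) (proj₂ (cut r′ ks)) (total≢0 (total-cut r′ ks r′<total)))
        (cong (k ∷_) (glue-cut r′ ks r′<total))
  where
  r′ = r ∸ suc k
  r′<total = ∸-bound (ℕ.≰⇒> r≰k) r<total

Compositions : ℕ → ℕ → Set
Compositions k t = Σ (List ℕ) λ ks → length ks ≡ k × total ks ≡ t

IsCompositionPair : ℕ → ℕ → ℕ → List ℕ × List ℕ → Set
IsCompositionPair k r s (u , v) = length u +ℕ length v ≡ suc k × total u ≡ suc r × total v ≡ suc s

IsCompositionPair-irrelevant : ∀ {k r s} uv → Irrelevant (IsCompositionPair k r s uv)
IsCompositionPair-irrelevant _ = ×-irrelevant ≡-irrelevant (×-irrelevant ≡-irrelevant ≡-irrelevant)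

CompositionPairs : ℕ → ℕ → ℕ → Set
CompositionPairs k r s = Σ (List ℕ × List ℕ) (IsCompositionPair k r s)

glue-↔ : ∀ {k r s} → CompositionPairs k r s ↔ Compositions k (r +ℕ suc s)
glue-↔ {k} {r} {s} = mk↔ₛ′ to from to∘from from∘to
  where
  to : CompositionPairs k r s → Compositions k (r +ℕ suc s)
  to ((u , v) , len , total-u , total-v) =
    glue u v ,
    ℕ.suc-injective (trans (length-glue u v (total≢0 total-u) (total≢0 total-v)) len) ,
    ℕ.suc-injective (trans (total-glue u v (total≢0 total-u) (total≢0 total-v)) (cong₂ _+ℕ_ total-u total-v))
  from : Compositions k (r +ℕ suc s) → CompositionPairs k r s
  r<total : ∀ ks → total ks ≡ r +ℕ suc s → suc r ≤ total ks
  r<total _ total-ks = subst (suc r ≤_) (sym total-ks) (ℕ.m<m+n r (s≤s z≤n))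
  from (ks , len , total-ks) =
    (u , v) ,
    trans (sym (length-glue u v u≢[] v≢[])) (cong suc (trans (cong length (glue-cut r ks (r<total ks total-ks))) len)) ,
    total-u ,
    ℕ.+-cancelˡ-≡ (suc r) _ _ (trans (cong (_+ℕ total v) (sym total-u))
      (trans (sym (total-glue u v u≢[] v≢[]))
             (cong suc (trans (cong total (glue-cut r ks (r<total ks total-ks))) total-ks))))
    where
    u = proj₁ (cut r ks)
    v = proj₂ (cut r ks)
    total-u = total-cut r ks (r<total ks total-ks)
    u≢[] = total≢0 {u} total-u
    v≢[] = cut-suffix≢[] r ks (r<total ks total-ks)
  to∘from : ∀ c → to (from c) ≡ c
  to∘from (ks , len , total-ks) =
    Σ-≡-irrelevant (×-irrelevant ≡-irrelevant ≡-irrelevant) (glue-cut r ks (r<total ks total-ks))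
  from∘to : ∀ p → from (to p) ≡ p
  from∘to ((u , v) , _ , total-u , total-v) =
    Σ-≡-irrelevant (λ {uv} → IsCompositionPair-irrelevant uv) (cut-glue r u v (total≢0 total-v) total-u)

-- Encoding lattice paths

YStep : ℕ → ℤ → Set
YStep n y = 1ℤ - + n ≤ℤ y × y ≤ℤ 1ℤ

module YWalks (n : ℕ) = Rotation (YStep n) (×-irrelevant ℤ.≤-irrelevant ℤ.≤-irrelevant) proj₂

open YWalks using (IsWalk; Walks; IsWalk-irrelevant; Walks-↔)

Walk : ℕ → Set
Walk n = Σ (List ℤ) (IsWalk n (suc n))

ysOf : ∀ {k} → Vec Step k → List ℤ
ysOf P = Vec.toList (Vec.map proj₂ P)

xsOf : ∀ {k} → Vec Step k → List ℕ
xsOf P = Vec.toList (Vec.map (λ step → ∣ proj₁ step ∣ ∸ 1) P)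

-- Pads with junk steps when a list is too short; every lemma below assumes matching lengths.
decode : (k : ℕ) → List ℤ → List ℕ → Vec Step k
decode zero    _        _        = []
decode (suc k) (y ∷ ys) (x ∷ xs) = (+ suc x , y) ∷ decode k ys xs
decode (suc k) _        _        = (1ℤ , 1ℤ) ∷ decode k [] []

pred-∣∣ : ∀ {x} → 1ℤ ≤ℤ x → + suc (∣ x ∣ ∸ 1) ≡ x
pred-∣∣ {+ suc _}  _        = refl
pred-∣∣ {+ zero}   (+≤+ ())

sumℤ-toList : ∀ {k} (v : Vec ℤ k) → sumℤ v ≡ ∑ (Vec.toList v)
sumℤ-toList []      = refl
sumℤ-toList (a ∷ v) = cong (_+_ a) (sumℤ-toList v)

sumℤ-xsOf : ∀ {n m k} (P : Vec Step k) → VecAll.All (StepOK n m) P → sumℤ (Vec.map proj₁ P) ≡ + total (xsOf P)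
sumℤ-xsOf []      VecAll.[]                   = refl
sumℤ-xsOf {n} {m} (_ ∷ P) ((_ , 1≤x , _) VecAll.∷ ok) = cong₂ _+_ (sym (pred-∣∣ 1≤x)) (sumℤ-xsOf {n} {m} P ok)

ysOf-steps : ∀ {n m k} (P : Vec Step k) → VecAll.All (StepOK n m) P → All (YStep n) (ysOf P)
ysOf-steps []      VecAll.[]                = []
ysOf-steps {n} {m} (_ ∷ P) ((y-ok , _) VecAll.∷ ok) = y-ok ∷ ysOf-steps {n} {m} P ok

decode-encode : ∀ {n m k} (P : Vec Step k) → VecAll.All (StepOK n m) P → decode k (ysOf P) (xsOf P) ≡ P
decode-encode []            VecAll.[]                   = refl
decode-encode {n} {m} ((_ , y) ∷ P) ((_ , 1≤x , _) VecAll.∷ ok) =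
  cong₂ _∷_ (cong (_, y) (pred-∣∣ 1≤x)) (decode-encode {n} {m} P ok)

encode-decode : ∀ k ys xs → length ys ≡ k → length xs ≡ k →
                ysOf (decode k ys xs) ≡ ys × xsOf (decode k ys xs) ≡ xs
encode-decode zero    []       []       _     _     = refl , refl
encode-decode (suc k) (y ∷ ys) (x ∷ xs) len-y len-x =
  let ys-eq , xs-eq = encode-decode k ys xs (ℕ.suc-injective len-y) (ℕ.suc-injective len-x)
  in cong (y ∷_) ys-eq , cong (x ∷_) xs-eq
encode-decode zero    (_ ∷ _)  _        ()    _
encode-decode zero    []       (_ ∷ _)  _     ()
encode-decode (suc k) []       _        ()    _
encode-decode (suc k) (_ ∷ _)  []       _     ()

part≤total : ∀ ks → All (λ x → suc x ≤ total ks) ks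
part≤total []       = []
part≤total (k ∷ ks) =
  ℕ.m≤m+n (suc k) (total ks) ∷ All.map (λ le → ℕ.≤-trans le (ℕ.m≤n+m _ (suc k))) (part≤total ks)

part<total : ∀ {ks} → 2 ≤ length ks → All (λ x → suc x < total ks) ks
part<total {_ ∷ []}      (s≤s ())
part<total {k ∷ k′ ∷ ks} _ =
  ℕ.m<m+n (suc k) (s≤s z≤n) ∷ All.map (λ le → s≤s (ℕ.≤-trans le (ℕ.m≤n+m _ k))) (part≤total (k′ ∷ ks))

decode-steps : ∀ {n m} k ys xs → length ys ≡ k → length xs ≡ k →
               All (YStep n) ys → All (λ x → suc x < m) xs → VecAll.All (StepOK n m) (decode k ys xs)
decode-steps zero    _        _        _     _     _             _             = VecAll.[]
decode-steps {n} {suc m} (suc k) (y ∷ ys) (x ∷ xs) len-y len-x (y-ok ∷ ys-ok) (s≤s x<m ∷ xs-ok) =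
  (y-ok , +≤+ (s≤s z≤n) , +≤+ x<m) VecAll.∷
  decode-steps {n} {suc m} k ys xs (ℕ.suc-injective len-y) (ℕ.suc-injective len-x) ys-ok xs-ok
decode-steps {m = zero} (suc k) (_ ∷ _) (_ ∷ _) _ _ _ (() ∷ _)
decode-steps (suc k) []       _        ()    _     _             _
decode-steps (suc k) (_ ∷ _)  []       _     ()    _             _

StepOK-irrelevant : ∀ n m {step} → Irrelevant (StepOK n m step)
StepOK-irrelevant _ _ =
  ×-irrelevant (×-irrelevant ℤ.≤-irrelevant ℤ.≤-irrelevant) (×-irrelevant ℤ.≤-irrelevant ℤ.≤-irrelevant)

IsLatticePath-irrelevant : ∀ {n m P} → Irrelevant (IsLatticePath n m P)
IsLatticePath-irrelevant {n} {m} p q =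
  cong (λ (b , y , x) → record { bounds = b ; sumY = y ; sumX = x })
       (×-irrelevant (VecAll.irrelevant (StepOK-irrelevant n m)) (×-irrelevant ≡-irrelevant ≡-irrelevant)
         (bounds p , sumY p , sumX p) (bounds q , sumY q , sumX q))
  where open IsLatticePath

path-↔ : ∀ {n m} → 1 ≤ n → LatticePath n m ↔ (Walk n × Compositions (suc n) m)
path-↔ {n} {m} 1≤n = mk↔ₛ′ encode decodePath encode∘decode decode∘encode
  where
  encode : LatticePath n m → Walk n × Compositions (suc n) m
  encode (P , lp) =
    (ysOf P , length-toList (Vec.map proj₂ P) , ysOf-steps {n} {m} P bounds ,
     trans (sym (sumℤ-toList (Vec.map proj₂ P))) sumY) ,
    (xsOf P , length-toList (Vec.map _ P) , ℤ.+-injective (trans (sym (sumℤ-xsOf {n} {m} P bounds)) sumX))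
    where open IsLatticePath lp
  decodePath : Walk n × Compositions (suc n) m → LatticePath n m
  decodePath ((ys , len-y , steps , ∑≡1) , (xs , len-x , total≡m)) = decode (suc n) ys xs , record
    { bounds = ok
    ; sumY   = trans (sumℤ-toList (Vec.map proj₂ path)) (trans (cong ∑ ys-eq) ∑≡1)
    ; sumX   = trans (sumℤ-xsOf {n} {m} path ok) (cong +_ (trans (cong total xs-eq) total≡m))
    }
    where
    path = decode (suc n) ys xs
    ys-eq = proj₁ (encode-decode (suc n) ys xs len-y len-x)
    xs-eq = proj₂ (encode-decode (suc n) ys xs len-y len-x)
    ok = decode-steps {n} {m} (suc n) ys xs len-y len-x steps
           (subst (λ t → All (λ x → suc x < t) xs) total≡m (part<total (subst (2 ≤_) (sym len-x) (s≤s 1≤n))))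
  encode∘decode : ∀ b → encode (decodePath b) ≡ b
  encode∘decode ((ys , len-y , _) , (xs , len-x , _)) =
    cong₂ _,_ (Σ-≡-irrelevant (IsWalk-irrelevant n) (proj₁ (encode-decode (suc n) ys xs len-y len-x)))
              (Σ-≡-irrelevant (×-irrelevant ≡-irrelevant ≡-irrelevant)
                              (proj₂ (encode-decode (suc n) ys xs len-y len-x)))
  decode∘encode : ∀ a → decodePath (encode a) ≡ a
  decode∘encode (P , lp) = Σ-≡-irrelevant IsLatticePath-irrelevant (decode-encode {n} {m} P (IsLatticePath.bounds lp))

npl-decode : ∀ s k ys xs → length ys ≡ k → length xs ≡ k →
             nplFrom s (decode k ys xs) ≡ + total (select (nonPosMask s ys) xs)
npl-decode s zero    []       []       _     _     = refl
npl-decode s (suc k) (y ∷ ys) (x ∷ xs) len-y len-x with s + y ≤ℤ? 0ℤ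
... | yes _ = cong (_+_ (+ suc x)) (npl-decode (s + y) k ys xs (ℕ.suc-injective len-y) (ℕ.suc-injective len-x))
... | no  _ = trans (ℤ.+-identityˡ _) (npl-decode (s + y) k ys xs (ℕ.suc-injective len-y) (ℕ.suc-injective len-x))
npl-decode s zero    (_ ∷ _)  _        ()    _
npl-decode s zero    []       (_ ∷ _)  _     ()
npl-decode s (suc k) []       _        ()    _
npl-decode s (suc k) (_ ∷ _)  []       _     ()

npl-decodePath : ∀ {n m} (1≤n : 1 ≤ n) (b : Walk n × Compositions (suc n) m) →
                 NPL (proj₁ (Inverse.from (path-↔ 1≤n) b))
                   ≡ + total (select (nonPosMask 0ℤ (proj₁ (proj₁ b))) (proj₁ (proj₂ b)))
npl-decodePath {n} _ ((ys , len-y , _) , (xs , len-x , _)) = npl-decode 0ℤ (suc n) ys xs len-y len-x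

lastX-decode : ∀ n ys xs x → length ys ≡ suc n → length xs ≡ n → lastX (decode (suc n) ys (xs ∷ʳ x)) ≡ + suc x
lastX-decode zero    (y ∷ [])     []        x _     _     = refl
lastX-decode (suc n) (y ∷ ys)     (x′ ∷ xs) x len-y len-x =
  lastX-decode n ys xs x (ℕ.suc-injective len-y) (ℕ.suc-injective len-x)
lastX-decode zero    []           _         x ()    _
lastX-decode zero    (_ ∷ _ ∷ _)  _         x ()    _
lastX-decode zero    (_ ∷ [])     (_ ∷ _)   x _     ()
lastX-decode (suc n) []           _         x ()    _
lastX-decode (suc n) (_ ∷ _)      []        x _     ()

-- Paths with NPL = r

NonPosTotal : ∀ {n m} → ℕ → Walk n × Compositions (suc n) m → Set
NonPosTotal t ((ys , _) , (xs , _)) = total (select (nonPosMask 0ℤ ys) xs) ≡ t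

Splits : (n r s : ℕ) → Walk n → Set
Splits n r s (ys , _) = Σ (List ℕ × List ℕ) λ (u , v) → #nonPos 0ℤ ys ≡ length u × IsCompositionPair n r s (u , v)

length≡length-mask : ∀ {n ys} {xs : List ℕ} → IsWalk n (suc n) ys → length xs ≡ suc n →
                     length xs ≡ length (nonPosMask 0ℤ ys)
length≡length-mask {ys = ys} (len-y , _) len-x = trans len-x (sym (trans (length-nonPosMask 0ℤ ys) len-y))

length≡#false : ∀ bs (u v : List ℕ) {k} → length bs ≡ k → #true bs ≡ length u → length u +ℕ length v ≡ k →
                length v ≡ #false bs
length≡#false bs u v len-bs count len-uv = ℕ.+-cancelˡ-≡ (#true bs) _ _
  (trans (cong (_+ℕ length v) count) (trans len-uv (sym (trans (#true+#false bs) len-bs))))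

unmerge-↔ : ∀ {n r s} → Σ (Walk n × Compositions (suc n) (suc r +ℕ suc s)) (NonPosTotal (suc r))
                        ↔ Σ (Walk n) (Splits n r s)
unmerge-↔ {n} {r} {s} = mk↔ₛ′ to from to∘from from∘to
  where
  to : Σ (Walk n × Compositions (suc n) (suc r +ℕ suc s)) (NonPosTotal (suc r)) → Σ (Walk n) (Splits n r s)
  to (((ys , w) , (xs , len-x , total-x)) , q) =
    (ys , w) , (select bs xs , reject bs xs) , sym (length-select bs xs len) ,
    trans (cong₂ _+ℕ_ (length-select bs xs len) (length-reject bs xs len))
          (trans (#true+#false bs) (trans (sym len) len-x)) ,
    q ,
    ℕ.+-cancelˡ-≡ (suc r) _ _
      (trans (cong (_+ℕ total (reject bs xs)) (sym q)) (trans (total-select-reject bs xs len) total-x))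
    where
    bs = nonPosMask 0ℤ ys
    len : length xs ≡ length bs
    len = length≡length-mask {xs = xs} w len-x
  from : Σ (Walk n) (Splits n r s) → Σ (Walk n × Compositions (suc n) (suc r +ℕ suc s)) (NonPosTotal (suc r))
  from ((ys , w) , (u , v) , count , len-uv , total-u , total-v) =
    ((ys , w) , merge bs u v , trans len-merge len-bs ,
       trans (sym (total-select-reject bs (merge bs u v) len-merge))
             (cong₂ _+ℕ_ (trans (cong total (select-merge bs u v len-u len-v)) total-u)
                         (trans (cong total (reject-merge bs u v len-u len-v)) total-v))) ,
    trans (cong total (select-merge bs u v len-u len-v)) total-u
    where
    bs = nonPosMask 0ℤ ys
    len-bs : length bs ≡ suc n
    len-bs = trans (length-nonPosMask 0ℤ ys) (proj₁ w)
    len-u : length u ≡ #true bs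
    len-u = sym count
    len-v : length v ≡ #false bs
    len-v = length≡#false bs u v len-bs count len-uv
    len-merge : length (merge bs u v) ≡ length bs
    len-merge = length-merge bs u v len-u len-v
  to∘from : ∀ x → to (from x) ≡ x
  to∘from ((ys , w) , (u , v) , count , len-uv , _) =
    cong ((ys , w) ,_) (Σ-≡-irrelevant (λ {uv} → ×-irrelevant ≡-irrelevant (IsCompositionPair-irrelevant uv))
      (cong₂ _,_ (select-merge bs u v len-u len-v) (reject-merge bs u v len-u len-v)))
    where
    bs = nonPosMask 0ℤ ys
    len-u : length u ≡ #true bs
    len-u = sym count
    len-v : length v ≡ #false bs
    len-v = length≡#false bs u v (trans (length-nonPosMask 0ℤ ys) (proj₁ w)) count len-uv
  from∘to : ∀ x → from (to x) ≡ x
  from∘to (((ys , w) , (xs , len-x , _)) , _) =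
    Σ-≡-irrelevant ≡-irrelevant (cong ((ys , w) ,_) (Σ-≡-irrelevant (×-irrelevant ≡-irrelevant ≡-irrelevant)
      (merge-select-reject (nonPosMask 0ℤ ys) xs (length≡length-mask {xs = xs} w len-x))))

regroup-↔ : ∀ {n r s} → Σ (Walk n) (Splits n r s) ↔
            Σ (List ℕ × List ℕ) (λ (u , v) → IsCompositionPair n r s (u , v) × Walks n (suc n) (length u))
regroup-↔ = mk↔ₛ′ (λ ((ys , w) , uv , count , p) → uv , p , ys , w , count)
                  (λ (uv , p , ys , w , count) → (ys , w) , uv , count , p) (λ _ → refl) (λ _ → refl)

length-prefix≤ : ∀ {n r s} uv → IsCompositionPair n r s uv → length (proj₁ uv) ≤ n
length-prefix≤ (u , _ ∷ v) (len , _) =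
  subst (length u ≤_) (ℕ.suc-injective (trans (sym (ℕ.+-suc (length u) (length v))) len))
        (ℕ.m≤m+n (length u) (length v))

NPL≡r-↔ : ∀ {n r s} → 1 ≤ n →
          (Σ (LatticePath n (suc r +ℕ suc s)) λ P → NPL (proj₁ P) ≡ + suc r)
          ↔ (Compositions n (r +ℕ suc s) × Walks n (suc n) 0)
NPL≡r-↔ {n} {r} {s} 1≤n =
  ↔-trans (restrict-↔ (path-↔ 1≤n) ≡-irrelevant ≡-irrelevant
             (λ {b} npl≡r → ℤ.+-injective (trans (sym (npl-decodePath 1≤n b)) npl≡r))
             (λ {b} total≡r → trans (npl-decodePath 1≤n b) (cong +_ total≡r))) (
  ↔-trans unmerge-↔ (
  ↔-trans regroup-↔ (
  ↔-trans (Σ-×-↔ (λ {uv} p → Walks-↔ n (length-prefix≤ uv p)))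
          (glue-↔ ×-↔ ↔-refl))))

-- Paths with NPL = 0 and x_{n+1} = 1

EndsIn0 : List ℕ → Set
EndsIn0 xs = Σ (List ℕ) λ xs′ → xs ≡ xs′ ∷ʳ 0

EndsIn0-irrelevant : ∀ {xs} → Irrelevant (EndsIn0 xs)
EndsIn0-irrelevant (xs′ , eq) (xs″ , eq′) =
  Σ-≡-irrelevant ≡-irrelevant (∷ʳ-injectiveˡ xs′ xs″ (trans (sym eq) eq′))

lastX≡1⇒EndsIn0 : ∀ n ys xs → length ys ≡ suc n → length xs ≡ suc n →
                  lastX (decode (suc n) ys xs) ≡ 1ℤ → EndsIn0 xs
lastX≡1⇒EndsIn0 n ys xs len-y len-x last≡1 with initLast xs
... | []        with () ← len-x
... | xs′ ∷ʳ′ x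
  with len-xs′ ← ℕ.suc-injective (trans (sym (length-∷ʳ xs′ x)) len-x)
  with refl ← ℕ.suc-injective (ℤ.+-injective (trans (sym (lastX-decode n ys xs′ x len-y len-xs′)) last≡1)) =
  xs′ , refl

PositiveLastX1 : ∀ {n m} → Walk n × Compositions (suc n) m → Set
PositiveLastX1 ((ys , _) , (xs , _)) = #nonPos 0ℤ ys ≡ 0 × EndsIn0 xs

encode-NPL≡0∧lastX≡1-↔ : ∀ {n m} → 1 ≤ n →
                 (Σ (LatticePath n m) λ P → (NPL (proj₁ P) ≡ 0ℤ) × (lastX (proj₁ P) ≡ 1ℤ))
                 ↔ Σ (Walk n × Compositions (suc n) m) PositiveLastX1
encode-NPL≡0∧lastX≡1-↔ {n} {m} 1≤n =
  restrict-↔ (path-↔ 1≤n) (×-irrelevant ≡-irrelevant ≡-irrelevant) (×-irrelevant ≡-irrelevant EndsIn0-irrelevant)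
    (λ {b} → P⇒Q {b}) (λ {b} → Q⇒P {b})
  where
  Condition : LatticePath n m → Set
  Condition P = (NPL (proj₁ P) ≡ 0ℤ) × (lastX (proj₁ P) ≡ 1ℤ)
  P⇒Q : ∀ {b} → Condition (Inverse.from (path-↔ 1≤n) b) → PositiveLastX1 b
  P⇒Q {b@((ys , len-y , _) , (xs , len-x , _))} (npl≡0 , last≡1) =
    trans (sym (length-select bs xs (length≡length-mask {xs = xs} (proj₂ (proj₁ b)) len-x)))
          (cong length (total≡0 {select bs xs} (ℤ.+-injective (trans (sym (npl-decodePath 1≤n b)) npl≡0)))) ,
    lastX≡1⇒EndsIn0 n ys xs len-y len-x last≡1
    where bs = nonPosMask 0ℤ ys
  Q⇒P : ∀ {b} → PositiveLastX1 b → Condition (Inverse.from (path-↔ 1≤n) b)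
  Q⇒P {b@((ys , len-y , _) , (xs , len-x , _))} (none , xs′ , refl) =
    trans (npl-decodePath 1≤n b) (cong (λ t → + total t) (select-none (nonPosMask 0ℤ ys) xs none)) ,
    lastX-decode n ys xs′ 0 len-y (ℕ.suc-injective (trans (sym (length-∷ʳ xs′ 0)) len-x))

dropLast-↔ : ∀ {n m} → Σ (Walk n × Compositions (suc n) (suc m)) PositiveLastX1
                       ↔ (Walks n (suc n) 0 × Compositions n m)
dropLast-↔ {n} {m} = mk↔ₛ′ to from to∘from from∘to
  where
  to : Σ (Walk n × Compositions (suc n) (suc m)) PositiveLastX1 → Walks n (suc n) 0 × Compositions n m
  to (((ys , w) , (_ , len , total≡)) , none , xs′ , refl) =
    (ys , w , none) ,
    (xs′ , ℕ.suc-injective (trans (sym (length-∷ʳ xs′ 0)) len) ,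
           ℕ.suc-injective (trans (sym (total-∷ʳ0 xs′)) total≡))
  from : Walks n (suc n) 0 × Compositions n m → Σ (Walk n × Compositions (suc n) (suc m)) PositiveLastX1
  from ((ys , w , none) , (xs′ , len , total≡)) =
    ((ys , w) , (xs′ ∷ʳ 0 , trans (length-∷ʳ xs′ 0) (cong suc len) , trans (total-∷ʳ0 xs′) (cong suc total≡))) ,
    none , xs′ , refl
  to∘from : ∀ y → to (from y) ≡ y
  to∘from (walk , _) = cong (walk ,_) (Σ-≡-irrelevant (×-irrelevant ≡-irrelevant ≡-irrelevant) refl)
  from∘to : ∀ x → from (to x) ≡ x
  from∘to (((ys , w) , (_ , _ , _)) , _ , _ , refl) =
    Σ-≡-irrelevant (×-irrelevant ≡-irrelevant EndsIn0-irrelevant)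
      (cong ((ys , w) ,_) (Σ-≡-irrelevant (×-irrelevant ≡-irrelevant ≡-irrelevant) refl))

NPL≡0∧lastX≡1-↔ : ∀ {n m} → 1 ≤ n →
                  (Σ (LatticePath n (suc m)) λ P → (NPL (proj₁ P) ≡ 0ℤ) × (lastX (proj₁ P) ≡ 1ℤ))
                  ↔ (Walks n (suc n) 0 × Compositions n m)
NPL≡0∧lastX≡1-↔ 1≤n = ↔-trans (encode-NPL≡0∧lastX≡1-↔ 1≤n) dropLast-↔

<⇒∃+suc : ∀ {r m} → r < m → Σ ℕ λ s → r +ℕ suc s ≡ m
<⇒∃+suc {r} r<m = let s , eq = ℕ.m≤n⇒∃[o]m+o≡n r<m in s , trans (ℕ.+-suc r s) eq

theorem2p7 : (n m : ℕ) → 1 ≤ n → suc n ≤ m →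
    (r : ℕ) → 1 ≤ r → r ≤ m ∸ 1 →
    (Σ (LatticePath n m) (λ P → NPL (proj₁ P) ≡ + r))
      ↔ (Σ (LatticePath n m) (λ P → (NPL (proj₁ P) ≡ 0ℤ) × (lastX (proj₁ P) ≡ 1ℤ)))
theorem2p7 n zero    _   _ (suc r) _ ()
theorem2p7 n (suc m) 1≤n _ (suc r) _ r<m with s , refl ← <⇒∃+suc r<m =
  ↔-trans (NPL≡r-↔ 1≤n) (↔-trans (×-comm _ _) (↔-sym (NPL≡0∧lastX≡1-↔ 1≤n)))
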